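{- Let $t_n=(-1)^{s_2(n)}$, $h_0=0$, $h_1=1$, and $h_n=t_nh_{n-1}+h_{n-2}$ for $n\ge2$. Then for every integer $n>3$ we have $\sum_{i=0}^{n}h_i<0$.
   Context: $s_2(n)$ denotes the number of 1's in the binary expansion of $n$; $(t_n)$ is the Prouhet–Thue–Morse sequence. -}

module Defs where

open import Data.Nat using (ℕ; zero; suc; _+_; _/_; _%_)
open import Data.Integer as ℤ using (ℤ; +_; -_; _*_)
open import Data.Bool using (Bool; true; false)

-- number of 1's in the binary expansion of n, computed with fuel;
-- s₂ n uses fuel n, which suffices since n / 2 < n for n > 0.
s₂-aux : ℕ → ℕ → ℕ
s₂-aux zero    n = 0
s₂-aux (suc k) n = n % 2 + s₂-aux k (n / 2)

s₂ : ℕ → ℕ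
s₂ n = s₂-aux n n

neg1^ : ℕ → ℤ
neg1^ zero    = + 1
neg1^ (suc k) = - neg1^ k

t : ℕ → ℤ
t n = neg1^ (s₂ n)

h : ℕ → ℤ
h zero = + 0
h (suc zero) = + 1
h (suc (suc n)) = t (suc (suc n)) * h (suc n) ℤ.+ h n

H : ℕ → ℤ
H zero    = h zero
H (suc n) = H n ℤ.+ h (suc n)

-- On each block 4k, 4k+1, 4k+2, 4k+3 the Thue–Morse signs read s, −s, −s, s with s = t_k.
-- Running the recurrence across one block with p = h_{4k−2}, q = h_{4k−1} and S = H_{4k−1}
-- gives h_{4k+2} = 2p + s q and h_{4k+3} = s (p + s q), and shows that the condition
-- p < −|q|, S < −|q| is preserved while every partial sum inside the block is negative.
-- The condition holds at k = 2 (h₆ = −2, h₇ = 1, H₇ = −3); H₄, …, H₇ are checked directly.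
module Submission where

open import Defs
open import Data.Nat using (ℕ)
open import Data.Integer using (+_; _<_)

open import Data.Nat as ℕ using (zero; suc; z≤n; s≤s; _%_; _/_)
import Data.Nat.Properties as ℕ
open import Data.Nat.DivMod
  using (m/n<m; m*n%n≡0; m*n/n≡m; [m+kn]%n≡m%n; +-distrib-/-∣ʳ; m≡m%n+[m/n]*n; m%n<n; m≥n⇒m/n>0)
open import Data.Nat.Divisibility using (divides-refl)
open import Data.Integer using (ℤ; -_; _+_; _-_; _*_; _≤_; 0ℤ; 1ℤ; -1ℤ; -<+)
import Data.Integer.Properties as ℤ
open import Data.Integer.Tactic.RingSolver using (solve)
open import Data.List using ([]; _∷_)
open import Data.Product using (_×_; _,_; proj₁; proj₂)
open import Data.Sum using (_⊎_; inj₁; inj₂; map; swap)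
open import Relation.Binary.PropositionalEquality
open import Relation.Nullary using (yes; no; contradiction)

s₂-aux-zero : ∀ fuel → s₂-aux fuel 0 ≡ 0
s₂-aux-zero zero       = refl
s₂-aux-zero (suc fuel) = s₂-aux-zero fuel

half-suc≤ : ∀ m → suc m / 2 ℕ.≤ m
half-suc≤ m = ℕ.≤-pred (m/n<m (suc m) 2 (s≤s (s≤s z≤n)))

s₂-aux-fuel : ∀ {f g} n → n ℕ.≤ f → n ℕ.≤ g → s₂-aux f n ≡ s₂-aux g n
s₂-aux-fuel {f} {g} zero _ _ = trans (s₂-aux-zero f) (sym (s₂-aux-zero g))
s₂-aux-fuel {suc f} {suc g} (suc m) (s≤s m≤f) (s≤s m≤g) =
  cong (suc m % 2 ℕ.+_)
       (s₂-aux-fuel (suc m / 2) (ℕ.≤-trans (half-suc≤ m) m≤f) (ℕ.≤-trans (half-suc≤ m) m≤g))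

s₂-unfold : ∀ n → s₂ n ≡ n % 2 ℕ.+ s₂ (n / 2)
s₂-unfold zero    = refl
s₂-unfold (suc m) = cong (suc m % 2 ℕ.+_) (s₂-aux-fuel (suc m / 2) (half-suc≤ m) ℕ.≤-refl)

s₂-double : ∀ m → s₂ (m ℕ.* 2) ≡ s₂ m
s₂-double m = trans (s₂-unfold (m ℕ.* 2)) (cong₂ ℕ._+_ (m*n%n≡0 m 2) (cong s₂ (m*n/n≡m m 2)))

s₂-double+1 : ∀ m → s₂ (1 ℕ.+ m ℕ.* 2) ≡ 1 ℕ.+ s₂ m
s₂-double+1 m =
  trans (s₂-unfold (1 ℕ.+ m ℕ.* 2)) (cong₂ ℕ._+_ ([m+kn]%n≡m%n 1 m 2) (cong s₂ half))
  where
  half : (1 ℕ.+ m ℕ.* 2) / 2 ≡ m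
  half = trans (+-distrib-/-∣ʳ 1 {d = 2} (divides-refl m)) (m*n/n≡m m 2)

t-double : ∀ m → t (m ℕ.* 2) ≡ t m
t-double m = cong neg1^ (s₂-double m)

t-double+1 : ∀ m → t (1 ℕ.+ m ℕ.* 2) ≡ - t m
t-double+1 m = cong neg1^ (s₂-double+1 m)

neg1^-unit : ∀ k → neg1^ k ≡ 1ℤ ⊎ neg1^ k ≡ -1ℤ
neg1^-unit zero    = inj₁ refl
neg1^-unit (suc k) = swap (map (cong (-_)) (cong (-_)) (neg1^-unit k))

t-unit : ∀ n → t n ≡ 1ℤ ⊎ t n ≡ -1ℤ
t-unit n = neg1^-unit (s₂ n)

t-block : ∀ j → t (j ℕ.* 4) ≡ t j × t (1 ℕ.+ j ℕ.* 4) ≡ - t j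
              × t (2 ℕ.+ j ℕ.* 4) ≡ - t j × t (3 ℕ.+ j ℕ.* 4) ≡ t j
t-block j rewrite sym (ℕ.*-assoc j 2 2) =
    trans (t-double (j ℕ.* 2)) (t-double j)
  , trans (t-double+1 (j ℕ.* 2)) (cong (-_) (t-double j))
  , trans (t-double (1 ℕ.+ j ℕ.* 2)) (t-double+1 j)
  , trans (t-double+1 (1 ℕ.+ j ℕ.* 2))
          (trans (cong (-_) (t-double+1 j)) (ℤ.neg-involutive (t j)))

infixl 6 _⊕_
infix  5 _by_

_⊕_ : ∀ {x y} → x < 0ℤ → y < 0ℤ → x + y < 0ℤ
_⊕_ = ℤ.+-mono-<

_by_ : ∀ {x y} → x < 0ℤ → y ≡ x → y < 0ℤ
x<0 by refl = x<0

dominated-negative : ∀ {x y} → x + y < 0ℤ → x - y < 0ℤ → x < 0ℤ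
dominated-negative {x} {y} x+y<0 x-y<0 with x ℤ.<? 0ℤ
... | yes x<0 = x<0
... | no  x≮0 = contradiction x+x<0 (ℤ.≤⇒≯ (ℤ.+-mono-≤ 0≤x 0≤x))
  where
  0≤x : 0ℤ ≤ x
  0≤x = ℤ.≮⇒≥ x≮0
  x+x<0 : x + x < 0ℤ
  x+x<0 = x+y<0 ⊕ x-y<0 by solve (x ∷ y ∷ [])

record Invariant (p q S : ℤ) : Set where
  constructor invariant
  field
    p+q<0 : p + q < 0ℤ
    p-q<0 : p - q < 0ℤ
    S+q<0 : S + q < 0ℤ
    S-q<0 : S - q < 0ℤ

block-step : ∀ {s u v w x p q S} → s ≡ 1ℤ ⊎ s ≡ -1ℤ →
             u ≡ s → v ≡ - s → w ≡ - s → x ≡ s → Invariant p q S →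
             let a = u * q + p ; b = v * a + q ; c = w * b + a ; d = x * c + b
             in  S + a < 0ℤ × S + a + b < 0ℤ × S + a + b + c < 0ℤ
               × Invariant c d (S + a + b + c + d)
block-step {p = p} {q} {S} (inj₁ refl) refl refl refl refl (invariant p+q<0 p-q<0 S+q<0 S-q<0) =
  -- a = p + q, b = −p, c = 2p + q, d = p + q
    S+q<0 ⊕ p<0                         by solve (p ∷ q ∷ S ∷ [])
  , S+q<0                               by solve (p ∷ q ∷ S ∷ [])
  , S+q<0 ⊕ p+q<0 ⊕ p<0                 by solve (p ∷ q ∷ S ∷ [])
  , invariant (p+q<0 ⊕ p+q<0 ⊕ p<0       by solve (p ∷ q ∷ S ∷ []))
              (p<0                       by solve (p ∷ q ∷ S ∷ []))
              (S+q<0 ⊕ p+q<0 ⊕ p+q<0 ⊕ p+q<0 ⊕ p<0 by solve (p ∷ q ∷ S ∷ []))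
              (S+q<0 ⊕ p+q<0 ⊕ p<0       by solve (p ∷ q ∷ S ∷ []))
  where
  p<0 : p < 0ℤ
  p<0 = dominated-negative p+q<0 p-q<0
block-step {p = p} {q} {S} (inj₂ refl) refl refl refl refl (invariant p+q<0 p-q<0 S+q<0 S-q<0) =
  -- a = p − q, b = p, c = 2p − q, d = q − p
    S-q<0 ⊕ p<0                         by solve (p ∷ q ∷ S ∷ [])
  , S-q<0 ⊕ p<0 ⊕ p<0                   by solve (p ∷ q ∷ S ∷ [])
  , S-q<0 ⊕ p-q<0 ⊕ p<0 ⊕ p<0 ⊕ p<0     by solve (p ∷ q ∷ S ∷ [])
  , invariant (p<0                       by solve (p ∷ q ∷ S ∷ []))
              (p-q<0 ⊕ p-q<0 ⊕ p<0       by solve (p ∷ q ∷ S ∷ []))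
              (S-q<0 ⊕ p+q<0 ⊕ p<0       by solve (p ∷ q ∷ S ∷ []))
              (S-q<0 ⊕ p-q<0 ⊕ p<0 ⊕ p<0 ⊕ p<0 by solve (p ∷ q ∷ S ∷ []))
  where
  p<0 : p < 0ℤ
  p<0 = dominated-negative p+q<0 p-q<0

InvariantAt : ℕ → Set
InvariantAt m = Invariant (h m) (h (suc m)) (H (suc m))

h-block-step : ∀ j → InvariantAt (2 ℕ.+ j ℕ.* 4) →
               H (4 ℕ.+ j ℕ.* 4) < 0ℤ × H (5 ℕ.+ j ℕ.* 4) < 0ℤ × H (6 ℕ.+ j ℕ.* 4) < 0ℤ
             × InvariantAt (6 ℕ.+ j ℕ.* 4)
h-block-step j =
  let t₀ , t₁ , t₂ , t₃ = t-block (suc j) in block-step (t-unit (suc j)) t₀ t₁ t₂ t₃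

invariant-from-6 : ∀ j → InvariantAt (6 ℕ.+ j ℕ.* 4)
invariant-from-6 zero    = invariant -<+ -<+ -<+ -<+
invariant-from-6 (suc j) = proj₂ (proj₂ (proj₂ (h-block-step (suc j) (invariant-from-6 j))))

H-negative : ∀ j r → r ℕ.< 4 → H (r ℕ.+ suc j ℕ.* 4) < 0ℤ
H-negative zero 0 _ = -<+
H-negative zero 1 _ = -<+
H-negative zero 2 _ = -<+
H-negative zero 3 _ = -<+
H-negative (suc j) 0 _ = proj₁ (h-block-step (suc j) (invariant-from-6 j))
H-negative (suc j) 1 _ = proj₁ (proj₂ (h-block-step (suc j) (invariant-from-6 j)))
H-negative (suc j) 2 _ = proj₁ (proj₂ (proj₂ (h-block-step (suc j) (invariant-from-6 j))))
H-negative (suc j) 3 _ = dominated-negative S+q<0 S-q<0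
  where open Invariant (invariant-from-6 (suc j))
H-negative j (suc (suc (suc (suc r)))) (s≤s (s≤s (s≤s (s≤s ()))))

lemma2 : (n : ℕ) → 3 Data.Nat.< n → H n < + 0
lemma2 n 3<n with n / 4 | m≥n⇒m/n>0 {n} {4} 3<n | m≡m%n+[m/n]*n n 4
... | suc j | _ | n≡n%4+[1+j]*4 =
  subst (λ m → H m < 0ℤ) (sym n≡n%4+[1+j]*4) (H-negative j (n % 4) (m%n<n n 4))
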